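{- Let $T$ be a finite tree and $P=p_0p_1\dots p_k$ a path in $T$ whose interior vertices $p_1,\dots,p_{k-1}$ all have degree two in $T$. Let $T'$ be obtained from $T$ by deleting all edges between $p_k$ and $\Gamma(p_k)\setminus\{p_{k-1}\}$ and adding all edges between $p_0$ and $\Gamma(p_k)\setminus\{p_{k-1}\}$. Let $B$ be the vertex set of the component of $p_k$ in $T-E(P)$. Then for every integer $\ell\ge1$, \[\omega_{\ell}(p_0,T[B\cup P])-\omega_{\ell}(p_0,P)\leq \omega_{\ell}(p_0,T'[B\cup P])-\omega_{\ell}(p_0,P).\]
   Context: $\Gamma(v)$ is the set of neighbours of $v$ in $T$. For a graph $G$ and a vertex $x$, $\omega_\ell(x,G)$ is the number of walks of length $\ell$ in $G$ starting at $x$. $T[X]$, $T'[X]$ denote induced subgraphs on vertex set $X$; $P$ is regarded both as a path and as its vertex set. -}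

module Defs where

open import Data.Nat using (ℕ; zero; suc; _+_; _≤_)
open import Data.Fin using (Fin; zero; suc; inject₁; fromℕ; _≟_)
open import Data.Bool using (Bool; true; false; _∧_; _∨_; not; if_then_else_)
open import Data.Product using (_×_; Σ)
open import Relation.Nullary using (¬_)
open import Relation.Nullary.Decidable using (⌊_⌋)
open import Relation.Binary.PropositionalEquality using (_≡_; _≢_)
open import Relation.Binary.Construct.Closure.ReflexiveTransitive using (Star)
open import Function.Definitions using (Injective)

Adj : ℕ → Set
Adj n = Fin n → Fin n → Bool

_==_ : ∀ {n} → Fin n → Fin n → Bool
u == v = ⌊ u ≟ v ⌋

sumFin : ∀ {n} → (Fin n → ℕ) → ℕ
sumFin {zero}  f = 0
sumFin {suc n} f = f zero + sumFin (λ i → f (suc i))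

anyFin : ∀ {n} → (Fin n → Bool) → Bool
anyFin {zero}  f = false
anyFin {suc n} f = f zero ∨ anyFin (λ i → f (suc i))

deg : ∀ {n} → Adj n → Fin n → ℕ
deg A v = sumFin (λ u → if A v u then 1 else 0)

IsSimple : ∀ {n} → Adj n → Set
IsSimple A = (∀ u v → A u v ≡ A v u) × (∀ v → A v v ≡ false)

Edge : ∀ {n} → Adj n → Fin n → Fin n → Set
Edge A u v = A u v ≡ true

Reach : ∀ {n} → Adj n → Fin n → Fin n → Set
Reach A = Star (Edge A)

IsConnected : ∀ {n} → Adj n → Set
IsConnected A = ∀ u v → Reach A u v

record Cycle {n} (A : Adj n) : Set where
  field
    m      : ℕ
    c      : Fin (suc (suc (suc m))) → Fin n
    inj    : Injective _≡_ _≡_ c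
    consec : ∀ (i : Fin (suc (suc m))) → Edge A (c (inject₁ i)) (c (suc i))
    close  : Edge A (c (fromℕ (suc (suc m)))) (c zero)

IsTree : ∀ {n} → Adj n → Set
IsTree A = IsSimple A × IsConnected A × ¬ Cycle A

IsPath : ∀ {n k} → Adj n → (Fin (suc k) → Fin n) → Set
IsPath {k = k} A p =
  Injective _≡_ _≡_ p × (∀ (i : Fin k) → Edge A (p (inject₁ i)) (p (suc i)))

pathSet : ∀ {n k} → (Fin (suc k) → Fin n) → Fin n → Bool
pathSet p v = anyFin (λ i → p i == v)

pathAdj : ∀ {n k} → (Fin (suc k) → Fin n) → Adj n
pathAdj {k = k} p u v =
  anyFin {k} (λ i → (p (inject₁ i) == u ∧ p (suc i) == v)
                  ∨ (p (inject₁ i) == v ∧ p (suc i) == u))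

deleteEdges : ∀ {n} → Adj n → Adj n → Adj n
deleteEdges A E u v = A u v ∧ not (E u v)

induced : ∀ {n} → Adj n → (Fin n → Bool) → Adj n
induced A X u v = A u v ∧ X u ∧ X v

_∪_ : ∀ {n} → (Fin n → Bool) → (Fin n → Bool) → Fin n → Bool
(X ∪ Y) v = X v ∨ Y v

-- ω_ℓ(x, G): number of walks of length ℓ in G starting at x.
walks : ∀ {n} → Adj n → ℕ → Fin n → ℕ
walks A zero    x = 1
walks A (suc l) x = sumFin (λ y → if A x y then walks A l y else 0)

-- For a path p_0 … p_k with k = suc m:
-- T' deletes all edges between p_k and N = Γ(p_k) \ {p_{k-1}}
-- and adds all edges between p_0 and N.
transform : ∀ {n m} → Adj n → (Fin (suc (suc m)) → Fin n) → Adj n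
transform {m = m} A p u v =
  (A u v ∧ not (cut u v ∨ cut v u)) ∨ (add u v ∨ add v u)
  where
    pk pk-1 p0 : _
    pk   = p (fromℕ (suc m))
    pk-1 = p (inject₁ (fromℕ m))
    p0   = p zero
    N : _ → Bool
    N w = A pk w ∧ not (w == pk-1)
    cut add : _ → _ → Bool
    cut x y = (x == pk) ∧ N y
    add x y = (x == p0) ∧ N y

-- Write G = T[B ∪ P] and G′ = T′[B ∪ P], and let N = Γ(p_k) ∖ {p_{k-1}}.
-- If N is empty, T′ = T and there is nothing to prove.  Otherwise:
--
--  * G′ is G with the path turned around: the mirror map p_i ↦ p_{k-i}
--    (fixing every other vertex) sends edges of G to edges of G′.  An
--    injective edge-preserving map can only increase walk counts
--    (walks-dominate), so ω_ℓ(p_k, G) ≤ ω_ℓ(p_0, G′).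
--  * Inside G, p_0 has at most as many walks as p_k: the first half of the
--    path carries no branches, so reflecting it about its midpoint
--    (walks-reflect) gives ω_ℓ(p_j) ≤ ω_ℓ(p_{2c-j}) for j ≤ c.  For even k this
--    compares p_0 with p_k directly; for odd k we extend the path by one
--    vertex of N and compare p_1 with p_k.
module Submission where

open import Defs
open import Data.Nat using (ℕ; zero; suc; _+_; _∸_; _≤_; _<_; z≤n; s≤s; s≤s⁻¹; _≤?_)
open import Data.Nat.Properties
open import Data.Fin as F using (Fin; zero; suc; inject₁; fromℕ; toℕ; fromℕ<; opposite)
open import Data.Fin.Properties using (any?; toℕ-fromℕ<; toℕ-inject₁; toℕ-fromℕ; toℕ<n; opposite-prop; opposite-involutive)
  renaming (suc-injective to Fin-suc-injective)
open import Data.Vec using (Vec; []; _∷_; lookup)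
import Data.Bool as Bool
open import Data.Bool using (Bool; true; false; _∧_; _∨_; not; if_then_else_)
open import Data.Bool.Properties using (∧-comm; ∧-identityʳ; ∧-zeroʳ; ∨-identityʳ; ∨-zeroʳ; ∨-comm; not-injective; ¬-not; not-¬)
open import Data.Unit using (⊤; tt)
open import Data.Integer using (+_; _-_) renaming (_≤_ to _≤ℤ_)
import Data.Integer as ℤ
import Data.Integer.Properties as ℤ
open import Data.Product using (_×_; _,_; Σ; proj₁; proj₂)
open import Data.Sum using (_⊎_; inj₁; inj₂; [_,_]′)
open import Data.Empty using (⊥; ⊥-elim)
open import Relation.Nullary using (¬_; yes; no)
open import Relation.Binary.PropositionalEquality
open import Relation.Binary.Construct.Closure.ReflexiveTransitive using (Star; ε; _◅_; _◅◅_)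
  renaming (map to Star-map)
open import Function.Bundles using (_⇔_; Equivalence)
open import Function.Definitions using (Injective)

∧-introduce : ∀ {a b} → a ≡ true → b ≡ true → a ∧ b ≡ true
∧-introduce refl refl = refl

∧-left : ∀ {a b} → a ∧ b ≡ true → a ≡ true
∧-left {true} _ = refl

∧-right : ∀ {a b} → a ∧ b ≡ true → b ≡ true
∧-right {true} h = h

∧-falseˡ : ∀ {a b} → a ≡ false → a ∧ b ≡ false
∧-falseˡ refl = refl

∧-falseʳ : ∀ {a b} → b ≡ false → a ∧ b ≡ false
∧-falseʳ {a} refl = ∧-zeroʳ a

∨-cases : ∀ {a b} → a ∨ b ≡ true → a ≡ true ⊎ b ≡ true
∨-cases {true} _ = inj₁ refl
∨-cases {false} h = inj₂ h

∨-introˡ : ∀ {a b} → a ≡ true → a ∨ b ≡ true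
∨-introˡ refl = refl

∨-introʳ : ∀ {a b} → b ≡ true → a ∨ b ≡ true
∨-introʳ {a} refl = ∨-zeroʳ a

==-sound : ∀ {n} {u v : Fin n} → (u == v) ≡ true → u ≡ v
==-sound {u = u} {v} h with u F.≟ v
... | yes e = e

==-complete : ∀ {n} {u v : Fin n} → u ≡ v → (u == v) ≡ true
==-complete {u = u} {v} e with u F.≟ v
... | yes _ = refl
... | no ne = ⊥-elim (ne e)

==-false : ∀ {n} {u v : Fin n} → u ≢ v → (u == v) ≡ false
==-false {u = u} {v} ne with u F.≟ v
... | yes e = ⊥-elim (ne e)
... | no _ = refl

anyFin-witness : ∀ {n} (f : Fin n → Bool) → anyFin f ≡ true → Σ (Fin n) λ i → f i ≡ true
anyFin-witness {suc n} f h with ∨-cases {f zero} h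
... | inj₁ e = zero , e
... | inj₂ e with anyFin-witness (λ i → f (suc i)) e
... | i , e′ = suc i , e′

anyFin-intro : ∀ {n} (f : Fin n → Bool) (i : Fin n) → f i ≡ true → anyFin f ≡ true
anyFin-intro f zero e = ∨-introˡ e
anyFin-intro f (suc i) e = ∨-introʳ {f zero} (anyFin-intro (λ j → f (suc j)) i e)

sum-cong : ∀ {n} {f g : Fin n → ℕ} → (∀ z → f z ≡ g z) → sumFin f ≡ sumFin g
sum-cong {zero} h = refl
sum-cong {suc n} h = cong₂ _+_ (h zero) (sum-cong (λ z → h (suc z)))

sum-mono : ∀ {n} {f g : Fin n → ℕ} → (∀ z → f z ≤ g z) → sumFin f ≤ sumFin g
sum-mono {zero} h = z≤n
sum-mono {suc n} h = +-mono-≤ (h zero) (sum-mono (λ z → h (suc z)))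

sum-zero : ∀ {n} {f : Fin n → ℕ} → (∀ z → f z ≡ 0) → sumFin f ≡ 0
sum-zero {zero} h = refl
sum-zero {suc n} h rewrite h zero = sum-zero (λ z → h (suc z))

without : ∀ {n} → Fin n → (Fin n → ℕ) → Fin n → ℕ
without a f z = if z == a then 0 else f z

without-other : ∀ {n} (a : Fin n) f {z} → z ≢ a → without a f z ≡ f z
without-other a f ne rewrite ==-false ne = refl

sum-split : ∀ {n} (a : Fin n) (f : Fin n → ℕ) → sumFin f ≡ f a + sumFin (without a f)
sum-split {suc n} zero f =
  cong (_+_ (f zero)) (sum-cong λ z → sym (without-other zero f {suc z} (λ ())))
sum-split {suc n} (suc a) f =
  begin
    f zero + sumFin (λ i → f (suc i))
  ≡⟨ cong (_+_ (f zero)) (sum-split a (λ i → f (suc i))) ⟩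
    f zero + (f (suc a) + sumFin (without a (λ i → f (suc i))))
  ≡⟨ +-comm (f zero) _ ⟩
    (f (suc a) + sumFin (without a (λ i → f (suc i)))) + f zero
  ≡⟨ +-assoc (f (suc a)) _ _ ⟩
    f (suc a) + (sumFin (without a (λ i → f (suc i))) + f zero)
  ≡⟨ cong (_+_ (f (suc a))) (+-comm _ (f zero)) ⟩
    f (suc a) + (f zero + sumFin (without a (λ i → f (suc i))))
  ≡⟨ cong (_+_ (f (suc a))) (cong₂ _+_ (sym (without-other (suc a) f {zero} (λ ()))) (sum-cong shift)) ⟩
    f (suc a) + sumFin (without (suc a) f)
  ∎
  where
    open ≡-Reasoning
    shift : ∀ i → without a (λ i → f (suc i)) i ≡ without (suc a) f (suc i)
    shift i with i F.≟ a | suc i F.≟ suc a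
    ... | yes _ | yes _ = refl
    ... | no _ | no _ = refl
    ... | yes e | no ne = ⊥-elim (ne (cong suc e))
    ... | no ne | yes e = ⊥-elim (ne (Fin-suc-injective e))

sum-≥-one : ∀ {n} (a : Fin n) (f : Fin n → ℕ) → f a ≤ sumFin f
sum-≥-one a f rewrite sum-split a f = m≤m+n (f a) _

sum-≥-two : ∀ {n} (a b : Fin n) (f : Fin n → ℕ) → a ≢ b → f a + f b ≤ sumFin f
sum-≥-two a b f a≢b rewrite sum-split a f =
  +-monoʳ-≤ (f a) (subst (_≤ _) (without-other a f (λ e → a≢b (sym e))) (sum-≥-one b (without a f)))

sum-≥-three : ∀ {n} (a b c : Fin n) (f : Fin n → ℕ) → a ≢ b → a ≢ c → b ≢ c →
              f a + f b + f c ≤ sumFin f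
sum-≥-three a b c f a≢b a≢c b≢c rewrite sum-split a f | +-assoc (f a) (f b) (f c) =
  +-monoʳ-≤ (f a) (subst₂ (λ x y → x + y ≤ _)
    (without-other a f (λ e → a≢b (sym e))) (without-other a f (λ e → a≢c (sym e)))
    (sum-≥-two b c (without a f) b≢c))

sum-single : ∀ {n} (a : Fin n) (f : Fin n → ℕ) → (∀ z → z ≢ a → f z ≡ 0) → sumFin f ≡ f a
sum-single a f off rewrite sum-split a f = trans (cong (_+_ (f a)) (sum-zero rest)) (+-identityʳ (f a))
  where
    rest : ∀ z → without a f z ≡ 0
    rest z with z F.≟ a
    ... | yes _ = refl
    ... | no ne = off z ne

sum-double : ∀ {n} (a b : Fin n) (f : Fin n → ℕ) → a ≢ b →
             (∀ z → z ≢ a → z ≢ b → f z ≡ 0) → sumFin f ≡ f a + f b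
sum-double a b f a≢b off rewrite sum-split a f =
  cong (_+_ (f a)) (trans (sum-single b (without a f) rest) (without-other a f (λ e → a≢b (sym e))))
  where
    rest : ∀ z → z ≢ b → without a f z ≡ 0
    rest z z≢b with z F.≟ a
    ... | yes _ = refl
    ... | no z≢a = off z z≢a z≢b

sum-injective : ∀ {a b} (φ : Fin a → Fin b) → Injective _≡_ _≡_ φ →
                (f : Fin b → ℕ) → sumFin (λ i → f (φ i)) ≤ sumFin f
sum-injective {zero} φ inj f = z≤n
sum-injective {suc a} φ inj f rewrite sum-split (φ zero) f =
  +-monoʳ-≤ (f (φ zero))
    (subst (_≤ sumFin (without (φ zero) f)) (sum-cong λ i → without-other (φ zero) f {φ (suc i)} (λ e → 0≢suc (inj e)))
      (sum-injective (λ i → φ (suc i)) (λ e → Fin-suc-injective (inj e)) (without (φ zero) f)))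
  where
    0≢suc : ∀ {i : Fin a} → suc i ≢ zero
    0≢suc ()

via : ∀ {n} → Adj n → (Fin n → ℕ) → Fin n → Fin n → ℕ
via G w x y = if G x y then w y else 0

via-edge : ∀ {n} (G : Adj n) w {x y} → G x y ≡ true → via G w x y ≡ w y
via-edge G w e rewrite e = refl

via-non-edge : ∀ {n} (G : Adj n) w {x y} → ¬ (G x y ≡ true) → via G w x y ≡ 0
via-non-edge G w {x} {y} ne with G x y
... | true = ⊥-elim (ne refl)
... | false = refl

via-≤ : ∀ {n} {G H : Adj n} {w w′ : Fin n → ℕ} {x x′ y y′} →
        (G x y ≡ true → H x′ y′ ≡ true × w y ≤ w′ y′) → via G w x y ≤ via H w′ x′ y′
via-≤ {G = G} {x = x} {y = y} h with G x y
... | false = z≤n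
... | true with h refl
... | e , le rewrite e = le

walks-cong : ∀ {n} {G H : Adj n} → (∀ u v → G u v ≡ H u v) → ∀ l x → walks G l x ≡ walks H l x
walks-cong eq zero x = refl
walks-cong {G = G} {H} eq (suc l) x = sum-cong λ y → cong₂ (λ b w → if b then w else 0) (eq x y) (walks-cong eq l y)

walks-≥-nbr : ∀ {n} {G : Adj n} {x y} l → G x y ≡ true → walks G l y ≤ walks G (suc l) x
walks-≥-nbr {G = G} {x} {y} l e = subst (_≤ walks G (suc l) x) (via-edge G (walks G l) e) (sum-≥-one y (via G (walks G l) x))

walks-≥-two-nbrs : ∀ {n} {G : Adj n} {x y z} l → G x y ≡ true → G x z ≡ true → y ≢ z →
                   walks G l y + walks G l z ≤ walks G (suc l) x
walks-≥-two-nbrs {G = G} {x} {y} {z} l ey ez y≢z =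
  subst (_≤ walks G (suc l) x) (cong₂ _+_ (via-edge G (walks G l) ey) (via-edge G (walks G l) ez)) (sum-≥-two y z (via G (walks G l) x) y≢z)

walks-one-nbr : ∀ {n} {G : Adj n} {x y} l → G x y ≡ true → (∀ {z} → G x z ≡ true → z ≡ y) →
                walks G (suc l) x ≡ walks G l y
walks-one-nbr {G = G} {x} {y} l e only =
  trans (sum-single y (via G (walks G l) x) (λ z z≢y → via-non-edge G (walks G l) (λ g → z≢y (only g)))) (via-edge G (walks G l) e)

walks-two-nbrs : ∀ {n} {G : Adj n} {x y z} l → G x y ≡ true → G x z ≡ true → y ≢ z →
                 (∀ {u} → G x u ≡ true → u ≡ y ⊎ u ≡ z) → walks G (suc l) x ≡ walks G l y + walks G l z
walks-two-nbrs {G = G} {x} {y} {z} l ey ez y≢z only =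
  trans (sum-double y z (via G (walks G l) x) y≢z off) (cong₂ _+_ (via-edge G (walks G l) ey) (via-edge G (walks G l) ez))
  where
    off : ∀ u → u ≢ y → u ≢ z → via G (walks G l) x u ≡ 0
    off u u≢y u≢z = via-non-edge G (walks G l) λ g → [ u≢y , u≢z ]′ (only g)

walks-grow : ∀ {n} (G : Adj n) → (∀ u v → G u v ≡ G v u) →
             ∀ l {x z} → G x z ≡ true → walks G l x ≤ walks G (suc l) x
walks-grow G G-sym zero e = walks-≥-nbr {G = G} 0 e
walks-grow G G-sym (suc l) {x} _ =
  sum-mono λ y → via-≤ {G = G} {G} {walks G l} {walks G (suc l)} λ g → g , walks-grow G G-sym l (trans (G-sym y x) g)

walks-dominate : ∀ {n} (G H : Adj n) (φ : Fin n → Fin n) → Injective _≡_ _≡_ φ →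
                 (∀ {x y} → G x y ≡ true → H (φ x) (φ y) ≡ true) →
                 ∀ l x → walks G l x ≤ walks H l (φ x)
walks-dominate G H φ φ-inj hom zero x = ≤-refl
walks-dominate G H φ φ-inj hom (suc l) x =
  begin
    sumFin (via G (walks G l) x)
  ≤⟨ sum-mono (λ y → via-≤ {G = G} {H} {walks G l} {walks H l} λ g → hom g , walks-dominate G H φ φ-inj hom l y) ⟩
    sumFin (λ y → via H (walks H l) (φ x) (φ y))
  ≤⟨ sum-injective φ φ-inj (via H (walks H l) (φ x)) ⟩
    sumFin (via H (walks H l) (φ x))
  ∎
  where open ≤-Reasoning

module _ {n} (G : Adj n) (G-sym : ∀ u v → G u v ≡ G v u) (q : ℕ → Fin n) (c : ℕ)
  (q-injective : ∀ {i j} → i ≤ c + c → j ≤ c + c → q i ≡ q j → i ≡ j)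
  (q-edge : ∀ {i} → i < c + c → G (q i) (q (suc i)) ≡ true)
  (q-bare : ∀ {j z} → j < c → G (q j) z ≡ true → z ≡ q (suc j) ⊎ Σ ℕ λ i → j ≡ suc i × z ≡ q i)
  where

  private
    q-edge⁻ : ∀ {i} → i < c + c → G (q (suc i)) (q i) ≡ true
    q-edge⁻ h = trans (G-sym _ _) (q-edge h)

    q-gap : ∀ {i} → suc (suc i) ≤ c + c → q i ≢ q (suc (suc i))
    q-gap {i} h e = <-irrefl (q-injective (≤-trans (n≤1+n i) (<⇒≤ h)) h e) (<-trans (n<1+n i) (n<1+n (suc i)))

    below-middle : ∀ {j} → j < c → j < c + c
    below-middle j<c = <-≤-trans j<c (m≤m+n _ _)

  walks-reflect : ∀ l {j r} → j + r ≡ c + c → j ≤ c → walks G l (q j) ≤ walks G l (q r)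
  walks-reflect zero _ _ = ≤-refl
  walks-reflect (suc l) {j} {r} eq j≤c with m≤n⇒m<n∨m≡n j≤c
  ... | inj₁ j<c = reflect-below j r eq j<c
    where
      reflect-below : ∀ j r → j + r ≡ c + c → j < c → walks G (suc l) (q j) ≤ walks G (suc l) (q r)
      reflect-below j zero eq j<c = ⊥-elim (<-irrefl eq (+-mono-<-≤ j<c z≤n))
      reflect-below zero (suc r) eq 0<c =
        begin
          walks G (suc l) (q 0)
        ≡⟨ walks-one-nbr l (q-edge (below-middle 0<c)) only-nbr ⟩
          walks G l (q 1)
        ≤⟨ walks-reflect l {1} {r} eq 0<c ⟩
          walks G l (q r)
        ≤⟨ walks-≥-nbr l (q-edge⁻ (≤-reflexive eq)) ⟩
          walks G (suc l) (q (suc r))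
        ∎
        where
          open ≤-Reasoning
          only-nbr : ∀ {z} → G (q 0) z ≡ true → z ≡ q 1
          only-nbr g with q-bare 0<c g
          ... | inj₁ e = e
          ... | inj₂ (_ , () , _)
      reflect-below (suc j) (suc r) eq j+1<c =
        begin
          walks G (suc l) (q (suc j))
        ≡⟨ walks-two-nbrs l (q-edge⁻ (below-middle (<-trans (n<1+n j) j+1<c))) (q-edge (below-middle j+1<c))
                          (q-gap (below-middle j+1<c)) two-nbrs ⟩
          walks G l (q j) + walks G l (q (suc (suc j)))
        ≤⟨ +-mono-≤ (walks-reflect l (trans (+-suc j (suc r)) eq) (≤-trans (n≤1+n j) (<⇒≤ j+1<c)))
                    (walks-reflect l (trans (cong suc (sym (+-suc j r))) eq) j+1<c) ⟩
          walks G l (q (suc (suc r))) + walks G l (q r)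
        ≤⟨ walks-≥-two-nbrs l (q-edge r+1<2c) (q-edge⁻ (<-trans (n<1+n r) r+1<2c))
                             (λ e → q-gap r+1<2c (sym e)) ⟩
          walks G (suc l) (q (suc r))
        ∎
        where
          open ≤-Reasoning
          r+1<2c : suc r < c + c
          r+1<2c = subst (suc r <_) eq (s≤s (m≤n+m (suc r) j))
          two-nbrs : ∀ {z} → G (q (suc j)) z ≡ true → z ≡ q j ⊎ z ≡ q (suc (suc j))
          two-nbrs g with q-bare j+1<c g
          ... | inj₁ e = inj₂ e
          ... | inj₂ (_ , refl , e) = inj₁ e
  ... | inj₂ refl with +-cancelˡ-≡ j r j eq
  ... | refl = ≤-refl

last-step : ∀ {n} {R : Fin n → Fin n → Set} {a b} → Star R a b → a ≢ b → Σ (Fin n) λ u → R u b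
last-step ε a≢b = ⊥-elim (a≢b refl)
last-step {a = a} {b} (_◅_ {j = u} s rest) a≢b with u F.≟ b
... | yes refl = a , s
... | no u≢b = last-step rest u≢b

-- In a tree, the only connection between the endpoints of an edge ab is
-- that edge: every walk from a to b avoiding it would contain a cycle.
module _ {n} (T : Adj n) (a b : Fin n) where

  AvoidEdge : Fin n → Fin n → Set
  AvoidEdge u v = T u v ≡ true × ¬ (u ≡ a × v ≡ b) × ¬ (u ≡ b × v ≡ a)

  Chain : ∀ {r} → Vec (Fin n) (suc r) → Set
  Chain {zero} (x ∷ []) = ⊤
  Chain {suc r} (x ∷ y ∷ ys) = AvoidEdge x y × Chain (y ∷ ys)

  chain-step : ∀ {r} (v : Vec (Fin n) (suc r)) → Chain v → (i : Fin r) →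
               AvoidEdge (lookup v (inject₁ i)) (lookup v (suc i))
  chain-step (x ∷ y ∷ ys) (h , _) zero = h
  chain-step (x ∷ y ∷ ys) (_ , ch) (suc i) = chain-step (y ∷ ys) ch i

  SimpleChain : Fin n → Fin n → Set
  SimpleChain u w = Σ ℕ λ r → Σ (Vec (Fin n) (suc r)) λ v →
    lookup v zero ≡ u × lookup v (fromℕ r) ≡ w × Chain v × Injective _≡_ _≡_ (lookup v)

  suffix : ∀ {u} r (v : Vec (Fin n) (suc r)) → Chain v → Injective _≡_ _≡_ (lookup v) →
           (i : Fin (suc r)) → lookup v i ≡ u → SimpleChain u (lookup v (fromℕ r))
  suffix r v ch inj zero e = r , v , e , refl , ch , inj
  suffix (suc r) (x ∷ y ∷ v) (_ , ch) inj (suc i) e =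
    suffix r (y ∷ v) ch (λ eq → Fin-suc-injective (inj eq)) i e

  simplify : ∀ {u w} → Star AvoidEdge u w → SimpleChain u w
  simplify {u} ε = 0 , u ∷ [] , refl , refl , tt , single-inj
    where
      single-inj : Injective _≡_ _≡_ (lookup (u ∷ []))
      single-inj {zero} {zero} _ = refl
  simplify {u} (s ◅ rest) with simplify rest
  ... | r , v , start , end , ch , inj with any? (λ i → lookup v i F.≟ u)
  ... | yes (i , e) = subst (SimpleChain u) end (suffix r v ch inj i e)
  simplify {u} (s ◅ rest) | r , x ∷ v , refl , end , ch , inj | no fresh =
    suc r , u ∷ x ∷ v , refl , end , (s , ch) , cons-inj
    where
      cons-inj : Injective _≡_ _≡_ (lookup (u ∷ x ∷ v))
      cons-inj {zero} {zero} _ = refl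
      cons-inj {zero} {suc j} e = ⊥-elim (fresh (j , sym e))
      cons-inj {suc i} {zero} e = ⊥-elim (fresh (i , e))
      cons-inj {suc i} {suc j} e = cong suc (inj e)

  edge-is-bridge : IsSimple T → ¬ Cycle T → T a b ≡ true → ¬ Star AvoidEdge a b
  edge-is-bridge (T-sym , T-loopless) acyclic ab walk with simplify walk
  ... | zero , x ∷ [] , refl , refl , _ with trans (sym (T-loopless x)) ab
  ... | ()
  edge-is-bridge _ _ _ _ | suc zero , x ∷ y ∷ [] , refl , refl , (step , _) , _ =
    proj₁ (proj₂ step) (refl , refl)
  edge-is-bridge (T-sym , _) acyclic ab _ | suc (suc r) , v , start , end , ch , inj =
    acyclic (record { m = r ; c = lookup v ; inj = inj
                    ; consec = λ i → proj₁ (chain-step v ch i)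
                    ; close = subst₂ (λ x y → T x y ≡ true) (sym end) (sym start) (trans (T-sym b a) ab) })

degree-two : ∀ {n} (A : Adj n) {v a b z} → deg A v ≡ 2 →
             A v a ≡ true → A v b ≡ true → a ≢ b → A v z ≡ true → z ≡ a ⊎ z ≡ b
degree-two A {v} {a} {b} {z} d va vb a≢b vz with z F.≟ a | z F.≟ b
... | yes e | _ = inj₁ e
... | no _ | yes e = inj₂ e
... | no z≢a | no z≢b = ⊥-elim (<-irrefl refl (subst (3 ≤_) d three))
  where
    one = via A (λ _ → 1) v
    three : 3 ≤ deg A v
    three = subst (_≤ deg A v)
      (cong₂ _+_ (cong₂ _+_ (via-edge A _ va) (via-edge A _ vb)) (via-edge A _ vz))
      (sum-≥-three a b z one a≢b (λ e → z≢a (sym e)) (λ e → z≢b (sym e)))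

induced-intro : ∀ {n} (A : Adj n) X {u v} → A u v ≡ true → X u ≡ true → X v ≡ true →
                induced A X u v ≡ true
induced-intro A X a xu xv = ∧-introduce a (∧-introduce xu xv)

induced-edge : ∀ {n} (A : Adj n) X {u v} → induced A X u v ≡ true → A u v ≡ true
induced-edge A X = ∧-left

induced-source : ∀ {n} (A : Adj n) X {u v} → induced A X u v ≡ true → X u ≡ true
induced-source A X {u} {v} g = ∧-left (∧-right {A u v} g)

induced-target : ∀ {n} (A : Adj n) X {u v} → induced A X u v ≡ true → X v ≡ true
induced-target A X {u} {v} g = ∧-right {X u} (∧-right {A u v} g)

induced-sym : ∀ {n} {A : Adj n} (X : Fin n → Bool) → (∀ u v → A u v ≡ A v u) →
              ∀ u v → induced A X u v ≡ induced A X v u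
induced-sym {A = A} X A-sym u v = cong₂ _∧_ (A-sym u v) (∧-comm (X u) (X v))

even-or-odd : ∀ x → (Σ ℕ λ c → c + c ≡ x) ⊎ (Σ ℕ λ c → suc (c + c) ≡ x)
even-or-odd zero = inj₁ (0 , refl)
even-or-odd (suc x) with even-or-odd x
... | inj₁ (c , e) = inj₂ (c , cong suc e)
... | inj₂ (c , e) = inj₁ (suc c , cong suc (trans (+-suc c c) e))

-- Reading a Fin-indexed sequence with ℕ indices (out of range: first entry).
at : ∀ {A : Set} {K} → (Fin (suc K) → A) → ℕ → A
at p zero = p zero
at {K = zero} p (suc j) = p zero
at {K = suc K} p (suc j) = at (λ i → p (suc i)) j

at-toℕ : ∀ {A : Set} {K} (p : Fin (suc K) → A) (i : Fin (suc K)) → at p (toℕ i) ≡ p i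
at-toℕ p zero = refl
at-toℕ {K = suc K} p (suc i) = at-toℕ (λ j → p (suc j)) i

keep-bit : ∀ t {c₁ c₂ a₁ a₂ : Bool} → c₁ ≡ false → c₂ ≡ false → a₁ ≡ false → a₂ ≡ false →
           (t ∧ not (c₁ ∨ c₂)) ∨ (a₁ ∨ a₂) ≡ t
keep-bit t refl refl refl refl = trans (∨-identityʳ (t ∧ true)) (∧-identityʳ t)

module Setting {n m} (T : Adj n) (p : Fin (suc (suc m)) → Fin n)
    (tree : IsTree T)
    (path : IsPath T p)
    (interior-deg : ∀ (i : Fin m) → deg T (p (suc (inject₁ i))) ≡ 2)
    (B : Fin n → Bool)
    (B-spec : ∀ v → (B v ≡ true) ⇔ Reach (deleteEdges T (pathAdj p)) (p (fromℕ (suc m))) v)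
  where

  T-sym : ∀ u v → T u v ≡ T v u
  T-sym = proj₁ (proj₁ tree)

  T-flip : ∀ {u v} → T u v ≡ true → T v u ≡ true
  T-flip {u} {v} e = trans (T-sym v u) e

  T-loopless : ∀ v → T v v ≡ false
  T-loopless = proj₂ (proj₁ tree)

  k : ℕ
  k = suc m

  P : ℕ → Fin n
  P = at p

  P-at : ∀ {j} (i : Fin (suc k)) → toℕ i ≡ j → P j ≡ p i
  P-at i refl = at-toℕ p i

  P-last : P k ≡ p (fromℕ k)
  P-last = P-at (fromℕ k) (toℕ-fromℕ k)

  P-penult : P m ≡ p (inject₁ (fromℕ m))
  P-penult = P-at (inject₁ (fromℕ m)) (trans (toℕ-inject₁ (fromℕ m)) (toℕ-fromℕ m))

  P-injective : ∀ {i j} → i ≤ k → j ≤ k → P i ≡ P j → i ≡ j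
  P-injective {i} {j} i≤k j≤k e =
    trans (sym (toℕ-fromℕ< (s≤s i≤k)))
      (trans (cong toℕ (proj₁ path (trans (sym (P-at fi (toℕ-fromℕ< _))) (trans e (P-at fj (toℕ-fromℕ< _))))))
        (toℕ-fromℕ< (s≤s j≤k)))
    where
      fi fj : Fin (suc k)
      fi = fromℕ< (s≤s i≤k)
      fj = fromℕ< (s≤s j≤k)

  P-edge : ∀ {i} → i < k → T (P i) (P (suc i)) ≡ true
  P-edge {i} (s≤s i≤m) =
    subst₂ (λ a b → T a b ≡ true)
      (sym (P-at (inject₁ fi) (trans (toℕ-inject₁ fi) (toℕ-fromℕ< _))))
      (sym (P-at (suc fi) (cong suc (toℕ-fromℕ< _))))
      (proj₂ path fi)
    where
      fi : Fin k
      fi = fromℕ< (s≤s i≤m)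

  P-gap : ∀ {i} → suc (suc i) ≤ k → P i ≢ P (suc (suc i))
  P-gap {i} h e = <-irrefl (P-injective (≤-trans (n≤1+n i) (<⇒≤ h)) h e) (<-trans (n<1+n i) (n<1+n (suc i)))

  interior-nbr : ∀ {i z} → suc i < k → T (P (suc i)) z ≡ true → z ≡ P i ⊎ z ≡ P (suc (suc i))
  interior-nbr {i} (s≤s i+1≤m) =
    degree-two T (subst (λ v → deg T v ≡ 2) (sym P-interior) (interior-deg fi))
      (T-flip (P-edge (≤-trans (n≤1+n (suc i)) (s≤s i+1≤m)))) (P-edge (s≤s i+1≤m)) (P-gap (s≤s i+1≤m))
    where
      fi : Fin m
      fi = fromℕ< i+1≤m
      P-interior : P (suc i) ≡ p (suc (inject₁ fi))
      P-interior = P-at (suc (inject₁ fi)) (cong suc (trans (toℕ-inject₁ fi) (toℕ-fromℕ< i+1≤m)))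

  pathAdj-cases : ∀ {u v} → pathAdj p u v ≡ true →
                  Σ ℕ λ i → i < k × ((u ≡ P i × v ≡ P (suc i)) ⊎ (v ≡ P i × u ≡ P (suc i)))
  pathAdj-cases h with anyFin-witness _ h
  ... | i , hit = toℕ i , toℕ<n i , orient (∨-cases hit)
    where
      lo : P (toℕ i) ≡ p (inject₁ i)
      lo = P-at (inject₁ i) (toℕ-inject₁ i)
      hi : P (suc (toℕ i)) ≡ p (suc i)
      hi = P-at (suc i) refl
      orient : ∀ {u v} → (p (inject₁ i) == u ∧ p (suc i) == v) ≡ true ⊎ (p (inject₁ i) == v ∧ p (suc i) == u) ≡ true →
               (u ≡ P (toℕ i) × v ≡ P (suc (toℕ i))) ⊎ (v ≡ P (toℕ i) × u ≡ P (suc (toℕ i)))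
      orient (inj₁ e) = inj₁ (sym (trans lo (==-sound (∧-left e))) , sym (trans hi (==-sound (∧-right e))))
      orient (inj₂ e) = inj₂ (sym (trans lo (==-sound (∧-left e))) , sym (trans hi (==-sound (∧-right e))))

  pathAdj-intro : ∀ {i u v} → i < k → (u ≡ P i × v ≡ P (suc i)) ⊎ (v ≡ P i × u ≡ P (suc i)) →
                  pathAdj p u v ≡ true
  pathAdj-intro {i} {u} {v} i<k dir =
    anyFin-intro (λ j → (p (inject₁ j) == u ∧ p (suc j) == v) ∨ (p (inject₁ j) == v ∧ p (suc j) == u)) fi (orient dir)
    where
      fi : Fin k
      fi = fromℕ< i<k
      lo : p (inject₁ fi) ≡ P i
      lo = sym (P-at (inject₁ fi) (trans (toℕ-inject₁ fi) (toℕ-fromℕ< i<k)))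
      hi : p (suc fi) ≡ P (suc i)
      hi = sym (P-at (suc fi) (cong suc (toℕ-fromℕ< i<k)))
      orient : ∀ {u v} → (u ≡ P i × v ≡ P (suc i)) ⊎ (v ≡ P i × u ≡ P (suc i)) →
               (p (inject₁ fi) == u ∧ p (suc fi) == v) ∨ (p (inject₁ fi) == v ∧ p (suc fi) == u) ≡ true
      orient (inj₁ (refl , refl)) = ∨-introˡ (∧-introduce (==-complete lo) (==-complete hi))
      orient (inj₂ (refl , refl)) = ∨-introʳ (∧-introduce (==-complete lo) (==-complete hi))

  pathSet-cases : ∀ {v} → pathSet p v ≡ true → Σ ℕ λ j → j ≤ k × P j ≡ v
  pathSet-cases h with anyFin-witness _ h
  ... | i , hit = toℕ i , s≤s⁻¹ (toℕ<n i) , trans (P-at i refl) (==-sound hit)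

  pathSet-intro : ∀ {j} → j ≤ k → pathSet p (P j) ≡ true
  pathSet-intro {j} j≤k = anyFin-intro (λ i → p i == P j) fj (==-complete (sym (P-at fj (toℕ-fromℕ< (s≤s j≤k)))))
    where
      fj : Fin (suc k)
      fj = fromℕ< (s≤s j≤k)

  off-path : ∀ {v j} → pathSet p v ≡ false → j ≤ k → v ≢ P j
  off-path off j≤k refl = not-¬ off (pathSet-intro j≤k)

  off-path-edge : ∀ {y z} → pathSet p y ≡ false → pathAdj p y z ≡ false
  off-path-edge {y} off = ¬-not meets
    where
      meets : pathAdj p y _ ≡ true → ⊥
      meets h with pathAdj-cases h
      ... | i , i<k , inj₁ (refl , _) = off-path off (<⇒≤ i<k) refl
      ... | i , i<k , inj₂ (_ , refl) = off-path off i<k refl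

  D : Adj n
  D = deleteEdges T (pathAdj p)

  B-reach : ∀ {v} → B v ≡ true → Reach D (P k) v
  B-reach {v} b = subst (λ a → Reach D a v) (sym P-last) (Equivalence.to (B-spec v) b)

  B-of-reach : ∀ {v} → Reach D (P k) v → B v ≡ true
  B-of-reach {v} r = Equivalence.from (B-spec v) (subst (λ a → Reach D a v) P-last r)

  B-last : B (P k) ≡ true
  B-last = B-of-reach ε

  B-closed : ∀ {y z} → B y ≡ true → T y z ≡ true → pathAdj p y z ≡ false → B z ≡ true
  B-closed b t off = B-of-reach (B-reach b ◅◅ (∧-introduce t (cong not off) ◅ ε))

  D-edge : ∀ {u v} → D u v ≡ true → T u v ≡ true × pathAdj p u v ≡ false
  D-edge h = ∧-left h , not-injective (∧-right h)

  last≢ : ∀ {i} → i < k → P k ≢ P i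
  last≢ i<k e = <-irrefl (P-injective (<⇒≤ i<k) ≤-refl (sym e)) i<k

  -- B misses the interior of P: the last step into p_{i+1} would be a path edge.
  B-avoids-interior : ∀ {i} → suc i < k → ¬ B (P (suc i)) ≡ true
  B-avoids-interior {i} i+1<k b with last-step (B-reach b) (last≢ i+1<k)
  ... | u , d with D-edge d
  ... | t , off with interior-nbr i+1<k (T-flip t)
  ... | inj₁ refl = not-¬ off (pathAdj-intro (<-trans (n<1+n i) i+1<k) (inj₁ (refl , refl)))
  ... | inj₂ refl = not-¬ off (pathAdj-intro i+1<k (inj₂ (refl , refl)))

  -- B misses p₀: otherwise p_k reaches p_{k-1} without the edge p_{k-1}p_k.
  B-avoids-first : ¬ B (P 0) ≡ true
  B-avoids-first b =
    edge-is-bridge T (P k) (P m) (proj₁ tree) (proj₂ (proj₂ tree)) (T-flip (P-edge ≤-refl))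
      (Star-map avoid (B-reach b) ◅◅ along m ≤-refl)
    where
      avoid : ∀ {u v} → D u v ≡ true → AvoidEdge T (P k) (P m) u v
      avoid d with D-edge d
      ... | t , off = t , (λ { (refl , refl) → not-¬ off (pathAdj-intro ≤-refl (inj₂ (refl , refl))) })
                        , (λ { (refl , refl) → not-¬ off (pathAdj-intro ≤-refl (inj₁ (refl , refl))) })
      along : ∀ j → j ≤ m → Star (AvoidEdge T (P k) (P m)) (P 0) (P j)
      along zero _ = ε
      along (suc j) j+1≤m = along j (≤-trans (n≤1+n j) j+1≤m) ◅◅ (step ◅ ε)
        where
          j<k : j < k
          j<k = ≤-trans (n≤1+n (suc j)) (s≤s j+1≤m)
          step : AvoidEdge T (P k) (P m) (P j) (P (suc j))
          step = P-edge j<k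
               , (λ { (e , _) → last≢ j<k (sym e) })
               , (λ { (_ , e) → <-irrefl (suc-injective (P-injective j<k ≤-refl e)) j+1≤m })

  B-on-path : ∀ {y} → pathSet p y ≡ true → B y ≡ true → y ≡ P k
  B-on-path on b with pathSet-cases on
  ... | zero , _ , refl = ⊥-elim (B-avoids-first b)
  ... | suc j , j+1≤k , refl with m≤n⇒m<n∨m≡n j+1≤k
  ... | inj₁ j+1<k = ⊥-elim (B-avoids-interior j+1<k b)
  ... | inj₂ refl = refl

  -- A neighbour of p₀ in B is joined to it by a path edge, hence is p₁.
  B-nbr-of-first : ∀ {z} → B z ≡ true → T (P 0) z ≡ true → z ≡ P 1
  B-nbr-of-first {z} b t with pathAdj p z (P 0) in on
  ... | false = ⊥-elim (B-avoids-first (B-closed b (T-flip t) on))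
  ... | true with pathAdj-cases on
  ... | i , i<k , inj₁ (_ , e) with P-injective z≤n i<k e
  ... | ()
  B-nbr-of-first {z} b t | true | i , i<k , inj₂ (e , refl) with P-injective z≤n (<⇒≤ i<k) e
  ... | refl = refl

  X : Fin n → Bool
  X = B ∪ pathSet p

  G : Adj n
  G = induced T X

  G-sym : ∀ u v → G u v ≡ G v u
  G-sym = induced-sym X T-sym

  X-path : ∀ {j} → j ≤ k → X (P j) ≡ true
  X-path {j} j≤k = ∨-introʳ {B (P j)} (pathSet-intro j≤k)

  X-cases : ∀ {v} → X v ≡ true → (Σ ℕ λ j → j ≤ k × P j ≡ v) ⊎ (B v ≡ true × pathSet p v ≡ false)
  X-cases {v} x with pathSet p v in on
  ... | true = inj₁ (pathSet-cases on)
  ... | false = inj₂ (trans (sym (∨-identityʳ (B v))) x , refl)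

  G-path-edge : ∀ {i} → i < k → G (P i) (P (suc i)) ≡ true
  G-path-edge i<k = induced-intro T X (P-edge i<k) (X-path (<⇒≤ i<k)) (X-path i<k)

  G-path-edge⁻ : ∀ {i} → i < k → G (P (suc i)) (P i) ≡ true
  G-path-edge⁻ {i} i<k = trans (G-sym (P (suc i)) (P i)) (G-path-edge i<k)

  G-from-B : ∀ {y z} → B y ≡ true → pathSet p y ≡ false → G y z ≡ true → B z ≡ true
  G-from-B b off g = B-closed b (induced-edge T X g) (off-path-edge off)

  N : Fin n → Bool
  N w = T (P k) w ∧ not (w == P m)

  -- N lies in B ∖ P: the edges from p_k into N are not path edges.
  N-in-B : ∀ {z} → N z ≡ true → B z ≡ true × pathSet p z ≡ false
  N-in-B {z} h = b , ¬-not (λ on → not-¬ (T-loopless (P k)) (subst (λ v → T (P k) v ≡ true) (B-on-path on b) t))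
    where
      t : T (P k) z ≡ true
      t = ∧-left h
      z≢P-m : z ≢ P m
      z≢P-m e = not-¬ (not-injective (∧-right h)) (==-complete e)
      not-path-edge : pathAdj p (P k) z ≡ false
      not-path-edge = ¬-not edge
        where
          edge : pathAdj p (P k) z ≡ true → ⊥
          edge h′ with pathAdj-cases h′
          ... | i , i<k , inj₁ (e , _) = last≢ i<k e
          ... | i , i<k , inj₂ (e , e′) with P-injective ≤-refl i<k e′
          ... | refl = z≢P-m e
      b : B z ≡ true
      b = B-closed B-last t not-path-edge

  N-of-B : ∀ {y} → B y ≡ true → pathSet p y ≡ false → T y (P k) ≡ true → N y ≡ true
  N-of-B off-b off t = ∧-introduce (T-flip t) (cong not (==-false (off-path off (n≤1+n m))))

  N-path : ∀ {j} → j ≤ k → N (P j) ≡ false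
  N-path j≤k = ¬-not λ h → not-¬ (proj₂ (N-in-B h)) (pathSet-intro j≤k)

  data PathNbr (j : ℕ) (y : Fin n) : Set where
    forward  : j < k → y ≡ P (suc j) → PathNbr j y
    backward : ∀ {i} → i < k → j ≡ suc i → y ≡ P i → PathNbr j y
    branch   : j ≡ k → N y ≡ true → PathNbr j y

  first-nbr : ∀ {z} → X z ≡ true → T (P 0) z ≡ true → z ≡ P 1
  first-nbr x t with X-cases x
  ... | inj₂ (b , _) = B-nbr-of-first b t
  ... | inj₁ (zero , _ , refl) = ⊥-elim (not-¬ (T-loopless (P 0)) t)
  ... | inj₁ (suc i , i+1≤k , refl) with m≤n⇒m<n∨m≡n i+1≤k
  ... | inj₂ refl = B-nbr-of-first B-last t
  ... | inj₁ i+1<k with interior-nbr i+1<k (T-flip t)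
  ... | inj₂ e with P-injective z≤n i+1<k e
  ... | ()
  first-nbr x t | inj₁ (suc i , i+1≤k , refl) | inj₁ i+1<k | inj₁ e with P-injective z≤n (≤-trans (n≤1+n i) (<⇒≤ i+1<k)) e
  ... | refl = refl

  path-nbr : ∀ {j y} → j ≤ k → G (P j) y ≡ true → PathNbr j y
  path-nbr {zero} _ g = forward (s≤s z≤n) (first-nbr (induced-target T X g) (induced-edge T X g))
  path-nbr {suc i} {y} i+1≤k g with m≤n⇒m<n∨m≡n i+1≤k
  ... | inj₁ i+1<k with interior-nbr i+1<k (induced-edge T X g)
  ... | inj₁ e = backward (<-trans (n<1+n i) i+1<k) refl e
  ... | inj₂ e = forward i+1<k e
  path-nbr {suc i} {y} i+1≤k g | inj₂ refl with y == P m in is-penult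
  ... | true = backward ≤-refl refl (==-sound is-penult)
  ... | false = branch refl (∧-introduce (induced-edge T X g) (cong not is-penult))

  bare-path-nbr : ∀ {j z} → j < k → G (P j) z ≡ true → z ≡ P (suc j) ⊎ Σ ℕ λ i → j ≡ suc i × z ≡ P i
  bare-path-nbr j<k g with path-nbr (<⇒≤ j<k) g
  ... | forward _ e = inj₁ e
  ... | backward _ e₁ e₂ = inj₂ (_ , e₁ , e₂)
  ... | branch refl _ = ⊥-elim (<-irrefl refl j<k)

  first-only-nbr : ∀ {z} → G (P 0) z ≡ true → z ≡ P 1
  first-only-nbr g with bare-path-nbr (s≤s z≤n) g
  ... | inj₁ e = e
  ... | inj₂ (_ , () , _)

  -- `reshape` spells out `transform` for given p_k, p_{k-1}, p₀; T′ is the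
  -- transformed tree with these vertices read as P k, P m, P 0.
  reshape : Fin n → Fin n → Fin n → Adj n
  reshape pk pk-1 p0 u v = (T u v ∧ not (cut u v ∨ cut v u)) ∨ (add u v ∨ add v u)
    where
      moved : Fin n → Bool
      moved w = T pk w ∧ not (w == pk-1)
      cut add : Fin n → Fin n → Bool
      cut x y = (x == pk) ∧ moved y
      add x y = (x == p0) ∧ moved y

  T′ : Adj n
  T′ = reshape (P k) (P m) (P 0)

  transform-T′ : ∀ u v → transform T p u v ≡ T′ u v
  transform-T′ u v = cong₂ (λ a b → reshape a b (P 0) u v) (sym P-last) (sym P-penult)

  T′-sym : ∀ u v → T′ u v ≡ T′ v u
  T′-sym u v = cong₂ _∨_ (cong₂ (λ t c → t ∧ not c) (T-sym u v) (∨-comm ((u == P k) ∧ N v) ((v == P k) ∧ N u)))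
                         (∨-comm ((u == P 0) ∧ N v) ((v == P 0) ∧ N u))

  T′-off-N : ∀ {u v} → N u ≡ false → N v ≡ false → T′ u v ≡ T u v
  T′-off-N {u} {v} nu nv = keep-bit (T u v) (∧-falseʳ {u == P k} nv) (∧-falseʳ {v == P k} nu)
                                            (∧-falseʳ {u == P 0} nv) (∧-falseʳ {v == P 0} nu)

  T′-away : ∀ {u v} → u ≢ P k → v ≢ P k → u ≢ P 0 → v ≢ P 0 → T′ u v ≡ T u v
  T′-away {u} {v} u≢k v≢k u≢0 v≢0 =
    keep-bit (T u v) (∧-falseˡ (==-false u≢k)) (∧-falseˡ (==-false v≢k))
                     (∧-falseˡ (==-false u≢0)) (∧-falseˡ (==-false v≢0))

  T′-added : ∀ {y} → N y ≡ true → T′ (P 0) y ≡ true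
  T′-added {y} ny =
    ∨-introʳ {T (P 0) y ∧ not (((P 0 == P k) ∧ N y) ∨ ((y == P k) ∧ N (P 0)))}
      (∨-introˡ (∧-introduce (==-complete {u = P 0} refl) ny))

  G′ : Adj n
  G′ = induced T′ X

  G′-flip : ∀ {u v} → G′ u v ≡ true → G′ v u ≡ true
  G′-flip {u} {v} g = trans (induced-sym X T′-sym v u) g

  G′-path-edge : ∀ {i} → i < k → G′ (P i) (P (suc i)) ≡ true
  G′-path-edge {i} i<k =
    induced-intro T′ X (trans (T′-off-N (N-path {i} (<⇒≤ i<k)) (N-path {suc i} i<k)) (P-edge i<k))
      (X-path {i} (<⇒≤ i<k)) (X-path {suc i} i<k)

  G′-branch : ∀ {y} → N y ≡ true → G′ (P 0) y ≡ true
  G′-branch ny = induced-intro T′ X (T′-added ny) (X-path z≤n) (∨-introˡ (proj₁ (N-in-B ny)))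

  mirror : Fin n → Fin n
  mirror v with any? (λ i → p i F.≟ v)
  ... | yes (i , _) = p (opposite i)
  ... | no _ = v

  mirror-on-path : ∀ i → mirror (p i) ≡ p (opposite i)
  mirror-on-path i with any? (λ j → p j F.≟ p i)
  ... | yes (j , e) = cong (λ j → p (opposite j)) (proj₁ path e)
  ... | no none = ⊥-elim (none (i , refl))

  mirror-off-path : ∀ {v} → pathSet p v ≡ false → mirror v ≡ v
  mirror-off-path {v} off with any? (λ i → p i F.≟ v)
  ... | yes (i , refl) = ⊥-elim (not-¬ off (anyFin-intro (λ j → p j == p i) i (==-complete refl)))
  ... | no _ = refl

  mirror-involutive : ∀ v → mirror (mirror v) ≡ v
  mirror-involutive v with pathSet p v in on
  ... | false = trans (cong mirror (mirror-off-path on)) (mirror-off-path on)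
  ... | true with anyFin-witness (λ i → p i == v) on
  ... | i , hit with ==-sound {u = p i} hit
  ... | refl = trans (cong mirror (mirror-on-path i))
                 (trans (mirror-on-path (opposite i)) (cong p (opposite-involutive i)))

  mirror-injective : Injective _≡_ _≡_ mirror
  mirror-injective {u} {v} e =
    trans (sym (mirror-involutive u)) (trans (cong mirror e) (mirror-involutive v))

  mirror-P : ∀ {i j} → i + j ≡ k → mirror (P i) ≡ P j
  mirror-P {i} {j} i+j =
    trans (cong mirror (P-at fi (toℕ-fromℕ< _)))
      (trans (mirror-on-path fi) (sym (P-at (opposite fi) index)))
    where
      i≤k : i ≤ k
      i≤k = subst (i ≤_) i+j (m≤m+n i j)
      fi : Fin (suc k)
      fi = fromℕ< (s≤s i≤k)
      index : toℕ (opposite fi) ≡ j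
      index = trans (opposite-prop fi)
                (trans (cong (k ∸_) (toℕ-fromℕ< (s≤s i≤k)))
                  (trans (cong (_∸ i) (sym i+j)) (m+n∸m≡n i j)))

  mirror-last : mirror (P k) ≡ P 0
  mirror-last = mirror-P {k} {0} (+-identityʳ k)

  mirror-path-edge : ∀ {i} → i < k → G′ (mirror (P i)) (mirror (P (suc i))) ≡ true
  mirror-path-edge {i} i<k =
    subst₂ (λ a b → G′ a b ≡ true) (sym (mirror-P {i} {suc j} i+[j+1])) (sym (mirror-P {suc i} {j} [i+1]+j))
      (G′-flip {P j} {P (suc j)} (G′-path-edge {j} j<k))
    where
      j : ℕ
      j = k ∸ suc i
      [i+1]+j : suc i + j ≡ k
      [i+1]+j = m+[n∸m]≡n i<k
      i+[j+1] : i + suc j ≡ k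
      i+[j+1] = trans (+-suc i j) [i+1]+j
      j<k : j < k
      j<k = subst (j <_) [i+1]+j (s≤s (m≤n+m j i))

  mirror-from-path : ∀ {j y} → PathNbr j y → G′ (mirror (P j)) (mirror y) ≡ true
  mirror-from-path (forward j<k refl) = mirror-path-edge j<k
  mirror-from-path (backward i<k refl refl) = G′-flip (mirror-path-edge i<k)
  mirror-from-path (branch refl ny) =
    subst₂ (λ a b → G′ a b ≡ true) (sym mirror-last) (sym (mirror-off-path (proj₂ (N-in-B ny))))
      (G′-branch ny)

  -- Edges leaving B ∖ P: those into p_k become the new edges at p₀, the rest stay.
  mirror-from-B : ∀ {x y} → B x ≡ true → pathSet p x ≡ false → G x y ≡ true →
                  G′ (mirror x) (mirror y) ≡ true
  mirror-from-B {x} {y} bx x-off g with pathSet p y Bool.≟ true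
  ... | yes y-on with B-on-path y-on (G-from-B bx x-off g)
  ... | refl rewrite mirror-off-path x-off | mirror-last =
    G′-flip (G′-branch (N-of-B bx x-off (induced-edge T X g)))
  mirror-from-B {x} {y} bx x-off g | no y-on rewrite mirror-off-path x-off | mirror-off-path (¬-not y-on) =
    induced-intro T′ X (trans (T′-away x≢Pk (off ≤-refl) x≢P0 (off z≤n)) (induced-edge T X g))
      (∨-introˡ bx) (∨-introˡ (G-from-B bx x-off g))
    where
      off : ∀ {j} → j ≤ k → y ≢ P j
      off = off-path (¬-not y-on)
      x≢Pk : x ≢ P k
      x≢Pk = off-path x-off ≤-refl
      x≢P0 : x ≢ P 0
      x≢P0 = off-path x-off z≤n

  mirror-embeds : ∀ {x y} → G x y ≡ true → G′ (mirror x) (mirror y) ≡ true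
  mirror-embeds g with X-cases (induced-source T X g)
  ... | inj₁ (j , j≤k , refl) = mirror-from-path (path-nbr j≤k g)
  ... | inj₂ (bx , x-off) = mirror-from-B bx x-off g

  last-to-first : ∀ l → walks G l (P k) ≤ walks G′ l (P 0)
  last-to-first l = subst (walks G l (P k) ≤_) (cong (walks G′ l) mirror-last)
    (walks-dominate G G′ mirror mirror-injective mirror-embeds l (P k))

  -- Inside G, p₀ has at most as many walks as p_k.  For k = 2c reflect the
  -- path itself about p_c.
  first-to-last-even : ∀ c → c + c ≡ k → ∀ l → walks G l (P 0) ≤ walks G l (P k)
  first-to-last-even c 2c≡k l =
    subst (λ r → walks G l (P 0) ≤ walks G l (P r)) 2c≡k
      (walks-reflect G G-sym P c
        (λ i≤2c j≤2c → P-injective (within i≤2c) (within j≤2c))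
        (λ i<2c → G-path-edge (within i<2c))
        (λ j<c → bare-path-nbr (<-≤-trans j<c (within (m≤m+n c c))))
        l refl z≤n)
    where
      within : ∀ {i} → i ≤ c + c → i ≤ k
      within {i} = subst (i ≤_) 2c≡k

  -- For k = 2c + 1, the path p₀ … p_k y extended by a vertex y ∈ N.
  extend : Fin n → ℕ → Fin n
  extend y j with j ≤? k
  ... | yes _ = P j
  ... | no _ = y

  extend-path : ∀ y {j} → j ≤ k → extend y j ≡ P j
  extend-path y {j} j≤k with j ≤? k
  ... | yes _ = refl
  ... | no j≰k = ⊥-elim (j≰k j≤k)

  extend-end : ∀ y → extend y (suc k) ≡ y
  extend-end y with suc k ≤? k
  ... | yes k+1≤k = ⊥-elim (<-irrefl refl k+1≤k)
  ... | no _ = refl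

  second-to-last : ∀ c → suc (c + c) ≡ k → ∀ {y} → N y ≡ true → ∀ l → walks G l (P 1) ≤ walks G l (P k)
  second-to-last c 2c+1≡k {y} ny l =
    subst₂ (λ a b → walks G l a ≤ walks G l b) (extend-path y (s≤s z≤n)) (extend-path y ≤-refl)
      (walks-reflect G G-sym (extend y) (suc c) q-injective q-edge q-bare l {1} {k} (sym 2c′≡k+1) (s≤s z≤n))
    where
      2c′≡k+1 : suc c + suc c ≡ suc k
      2c′≡k+1 = cong suc (trans (+-suc c c) 2c+1≡k)
      y-off : pathSet p y ≡ false
      y-off = proj₂ (N-in-B ny)
      q = extend y
      index-cases : ∀ {i} → i ≤ suc c + suc c → i ≡ suc k ⊎ i ≤ k
      index-cases {i} i≤ with m≤n⇒m<n∨m≡n (subst (i ≤_) 2c′≡k+1 i≤)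
      ... | inj₁ i<k+1 = inj₂ (s≤s⁻¹ i<k+1)
      ... | inj₂ e = inj₁ e
      q-injective : ∀ {i j} → i ≤ suc c + suc c → j ≤ suc c + suc c → q i ≡ q j → i ≡ j
      q-injective i≤ j≤ e with index-cases i≤ | index-cases j≤
      ... | inj₁ refl | inj₁ refl = refl
      ... | inj₁ refl | inj₂ j≤k = ⊥-elim (off-path y-off j≤k (trans (sym (extend-end y)) (trans e (extend-path y j≤k))))
      ... | inj₂ i≤k | inj₁ refl = ⊥-elim (off-path y-off i≤k (trans (sym (extend-end y)) (trans (sym e) (extend-path y i≤k))))
      ... | inj₂ i≤k | inj₂ j≤k = P-injective i≤k j≤k (trans (sym (extend-path y i≤k)) (trans e (extend-path y j≤k)))
      q-edge : ∀ {i} → i < suc c + suc c → G (q i) (q (suc i)) ≡ true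
      q-edge {i} i< with index-cases i<
      ... | inj₁ refl rewrite extend-path y {k} ≤-refl | extend-end y =
        induced-intro T X (∧-left ny) (X-path ≤-refl) (∨-introˡ (proj₁ (N-in-B ny)))
      ... | inj₂ i+1≤k rewrite extend-path y {i} (<⇒≤ i+1≤k) | extend-path y i+1≤k = G-path-edge i+1≤k
      below-k : ∀ {j} → j < suc c → j < k
      below-k {j} j<c+1 = subst (j <_) 2c+1≡k (s≤s (≤-trans (s≤s⁻¹ j<c+1) (m≤m+n c c)))
      q-bare : ∀ {j z} → j < suc c → G (q j) z ≡ true → z ≡ q (suc j) ⊎ Σ ℕ λ i → j ≡ suc i × z ≡ q i
      q-bare {j} {z} j<c+1 g
        with bare-path-nbr (below-k j<c+1) (subst (λ v → G v z ≡ true) (extend-path y (<⇒≤ (below-k j<c+1))) g)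
      ... | inj₁ e = inj₁ (trans e (sym (extend-path y (below-k j<c+1))))
      ... | inj₂ (i , refl , e) = inj₂ (i , refl , trans e (sym (extend-path y (≤-trans (n≤1+n i) (<⇒≤ (below-k j<c+1))))))

  first-to-last : ∀ {y} → N y ≡ true → ∀ ℓ → 1 ≤ ℓ → walks G ℓ (P 0) ≤ walks G ℓ (P k)
  first-to-last ny ℓ 1≤ℓ with even-or-odd k
  ... | inj₁ (c , 2c≡k) = first-to-last-even c 2c≡k ℓ
  first-to-last ny (suc l) _ | inj₂ (c , 2c+1≡k) =
    begin
      walks G (suc l) (P 0)   ≡⟨ walks-one-nbr l (G-path-edge (s≤s z≤n)) first-only-nbr ⟩
      walks G l (P 1)         ≤⟨ second-to-last c 2c+1≡k ny l ⟩
      walks G l (P k)         ≤⟨ walks-grow G G-sym l (G-path-edge⁻ {m} ≤-refl) ⟩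
      walks G (suc l) (P k)   ∎
    where open ≤-Reasoning

  transformed-G′ : ∀ u v → induced (transform T p) X u v ≡ G′ u v
  transformed-G′ u v = cong (λ t → t ∧ X u ∧ X v) (transform-T′ u v)

  walks-first : ∀ ℓ → 1 ≤ ℓ → walks G ℓ (P 0) ≤ walks (induced (transform T p) X) ℓ (P 0)
  walks-first ℓ 1≤ℓ = subst (walks G ℓ (P 0) ≤_) (sym (walks-cong transformed-G′ ℓ (P 0))) to-G′
    where
      to-G′ : walks G ℓ (P 0) ≤ walks G′ ℓ (P 0)
      to-G′ with any? (λ y → N y Bool.≟ true)
      ... | yes (y , ny) = ≤-trans (first-to-last ny ℓ 1≤ℓ) (last-to-first ℓ)
      ... | no N-empty = ≤-reflexive (walks-cong (λ u v → cong (λ t → t ∧ X u ∧ X v) (unchanged u v)) ℓ (P 0))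
        where
          unchanged : ∀ u v → T u v ≡ T′ u v
          unchanged u v = sym (T′-off-N (¬-not λ nu → N-empty (u , nu)) (¬-not λ nv → N-empty (v , nv)))

corollary5 : ∀ {n m} (T : Adj n) (p : Fin (suc (suc m)) → Fin n)
    → IsTree T
    → IsPath T p
    → (∀ (i : Fin m) → deg T (p (suc (inject₁ i))) ≡ 2)
    → (B : Fin n → Bool)
    → (∀ v → (B v ≡ true) ⇔ Reach (deleteEdges T (pathAdj p)) (p (fromℕ (suc m))) v)
    → ∀ (ℓ : ℕ) → 1 ≤ ℓ
    → (+ walks (induced T (B ∪ pathSet p)) ℓ (p zero) - + walks (pathAdj p) ℓ (p zero))
        ≤ℤ (+ walks (induced (transform T p) (B ∪ pathSet p)) ℓ (p zero) - + walks (pathAdj p) ℓ (p zero))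
corollary5 T p tree path interior-deg B B-spec ℓ 1≤ℓ =
  ℤ.+-monoˡ-≤ (ℤ.- (+ walks (pathAdj p) ℓ (p zero)))
    (ℤ.+≤+ (Setting.walks-first T p tree path interior-deg B B-spec ℓ 1≤ℓ))
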